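{- Let $k,s\ge 1$ be integers. Define $b:\mathbb Z\to\mathbb Z$ by $b(n)=\max(0,n)$ for $n<s$ and, for $n\ge s$, $$b(n)=\sum_{i=1}^{k}b\bigl(n-i-b(n-i)\bigr)+s.$$ Let $a(n)=n-b(n)$. Then for every $n\ge s$, $$a(n)=n-s-\sum_{i=1}^{k}a(n-i)+\sum_{i=1}^{k}a\bigl(a(n-i)\bigr).$$ -}

module Defs where

open import Data.Nat using (ℕ; zero; suc)
open import Data.Integer using (ℤ; +_; _+_; _-_; _<_; _≤_; _⊔_; 0ℤ)
open import Relation.Binary.PropositionalEquality using (_≡_)
open import Data.Product using (_×_)

sumFrom1 : ℕ → (ℕ → ℤ) → ℤ
sumFrom1 zero    f = 0ℤ
sumFrom1 (suc k) f = sumFrom1 k f + f (suc k)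

-- b : ℤ → ℤ satisfies the paper's defining equations for parameters k, s:
--   b(n) = max(0,n)                              for n < s
--   b(n) = Σ_{i=1}^k b(n - i - b(n - i)) + s     for n ≥ s
-- (These equations determine b uniquely, by well-founded recursion on n.)
IsB : ℕ → ℕ → (ℤ → ℤ) → Set
IsB k s b =
  (∀ (n : ℤ) → n < + s → b n ≡ 0ℤ ⊔ n) ×
  (∀ (n : ℤ) → + s ≤ n →
     b n ≡ sumFrom1 k (λ i → b ((n - + i) - b (n - + i))) + + s)

aOf : (ℤ → ℤ) → ℤ → ℤ
aOf b n = n - b n

-- Since a = id − b, we have b(x) = x − a(x) for every x; at x = a(n − i) = n − i − b(n − i)
-- this turns each summand of the recursion into a(n − i) − a(a(n − i)), and a(n) = n − b(n)
-- is then a rearrangement. Neither the initial values of b nor k, s ≥ 1 are needed.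
module Submission where

open import Defs
open import Data.Nat using (ℕ; _≥_; zero; suc)
open import Data.Integer using (ℤ; +_; _+_; _-_; _≤_)
open import Data.Integer.Tactic.RingSolver using (solve-∀)
open import Relation.Binary.PropositionalEquality using (_≡_; refl; cong; cong₂; module ≡-Reasoning)
open import Data.Product using (_,_)

sumFrom1-cong : ∀ k {f g : ℕ → ℤ} → (∀ i → f i ≡ g i) → sumFrom1 k f ≡ sumFrom1 k g
sumFrom1-cong zero    f≗g = refl
sumFrom1-cong (suc k) f≗g = cong₂ _+_ (sumFrom1-cong k f≗g) (f≗g (suc k))

sumFrom1-- : ∀ k (f g : ℕ → ℤ) →
             sumFrom1 k (λ i → f i - g i) ≡ sumFrom1 k f - sumFrom1 k g
sumFrom1-- zero    f g = refl
sumFrom1-- (suc k) f g = begin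
  sumFrom1 k (λ i → f i - g i) + (f (suc k) - g (suc k))
    ≡⟨ cong (_+ (f (suc k) - g (suc k))) (sumFrom1-- k f g) ⟩
  (sumFrom1 k f - sumFrom1 k g) + (f (suc k) - g (suc k))
    ≡⟨ interchange (sumFrom1 k f) (sumFrom1 k g) (f (suc k)) (g (suc k)) ⟩
  (sumFrom1 k f + f (suc k)) - (sumFrom1 k g + g (suc k))                  ∎
  where
  open ≡-Reasoning
  interchange : ∀ w x y z → (w - x) + (y - z) ≡ (w + y) - (x + z)
  interchange = solve-∀

b≡id-a : ∀ (b : ℤ → ℤ) x → b x ≡ x - aOf b x
b≡id-a b x = cancel x (b x)
  where
  cancel : ∀ y z → z ≡ y - (y - z)
  cancel = solve-∀

corollary6 : (k s : ℕ) → k ≥ 1 → s ≥ 1 → (b : ℤ → ℤ) → IsB k s b →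
    ∀ (n : ℤ) → + s ≤ n →
      aOf b n ≡ ((n - + s) - sumFrom1 k (λ i → aOf b (n - + i)))
                  + sumFrom1 k (λ i → aOf b (aOf b (n - + i)))
corollary6 k s _ _ b (_ , b-rec) n s≤n = begin
  n - b n
    ≡⟨ cong (n -_) (b-rec n s≤n) ⟩
  n - (sumFrom1 k (λ i → b (a (n - + i))) + + s)
    ≡⟨ cong (λ t → n - (t + + s)) (sumFrom1-cong k (λ i → b≡id-a b (a (n - + i)))) ⟩
  n - (sumFrom1 k (λ i → a (n - + i) - a (a (n - + i))) + + s)
    ≡⟨ cong (λ t → n - (t + + s)) (sumFrom1-- k (λ i → a (n - + i)) (λ i → a (a (n - + i)))) ⟩
  n - ((A - B) + + s)
    ≡⟨ rearrange n (+ s) A B ⟩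
  ((n - + s) - A) + B                                                       ∎
  where
  open ≡-Reasoning
  a : ℤ → ℤ
  a = aOf b
  A B : ℤ
  A = sumFrom1 k (λ i → a (n - + i))
  B = sumFrom1 k (λ i → a (a (n - + i)))
  rearrange : ∀ m t x y → m - ((x - y) + t) ≡ ((m - t) - x) + y
  rearrange = solve-∀
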